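{- Let $p(x)=a_0+a_1x+\dots+a_mx^m$ be a skew-palindromic polynomial of degree $m$ over a field $F$ of characteristic zero, and let $a_{k,n}$ denote the entries of its binomial array $B(p(x))$. (1) If $m=2l$, then $a_l=0$, and $a_{l+k,2k}=0$ for all integers $k\ge0$. (2) If $m=2l+1$, then $a_{l+1,1}=0$, and $a_{l+k+1,2k+1}=0$ for all integers $k\ge0$.
   Context: A polynomial $p(x)$ of degree $m$ is skew-palindromic if $p(x)=-x^mp(1/x)$, i.e. $a_k=-a_{m-k}$ for $0\le k\le m$. The binomial array $B(p(x))$ has entries $a_{k,n}$ ($k\ge0$, $n\in\mathbb{Z}$) equal to the coefficient of $x^k$ in $(1+x)^np(x)$. -}

module Defs where

open import Level using (Level; _⊔_)
open import Algebra.Bundles using (CommutativeRing; Semiring)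
import Algebra.Definitions.RawSemiring as RS
open import Data.Nat as ℕ using (ℕ; zero; suc; _∸_; _≤_)
open import Data.Nat.Combinatorics using (_C_)
open import Data.Integer as ℤ using (ℤ; +_; -[1+_])
open import Data.Product using (Σ; _×_)
open import Relation.Nullary using (¬_)

record Field (c ℓ : Level) : Set (Level.suc (c ⊔ ℓ)) where
  field
    commutativeRing : CommutativeRing c ℓ
  open CommutativeRing commutativeRing public
  field
    0≉1     : ¬ (0# ≈ 1#)
    inverse : ∀ x → ¬ (x ≈ 0#) → Σ Carrier (λ y → (x * y) ≈ 1#)

-- Generalized binomial coefficient  binom(n, i)  for n ∈ ℤ, i ∈ ℕ,
-- i.e. the coefficient of x^i in (1+x)^n (a power series if n < 0):
--   binom(n, i)      = n C i                       for n ≥ 0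
--   binom(-(n+1), i) = (-1)^i · ((n+i) C i)
gbinom : ℤ → ℕ → ℤ
gbinom (+ n)    i = + (n C i)
gbinom -[1+ n ] i = sign i ℤ.* (+ ((n ℕ.+ i) C i))
  where
  sign : ℕ → ℤ
  sign zero    = + 1
  sign (suc j) = ℤ.- sign j

module _ {c ℓ} (F : Field c ℓ) where
  open Field F
  open RS (Semiring.rawSemiring semiring) using () renaming (_×_ to _·_)

  CharZero : Set ℓ
  CharZero = ∀ (n : ℕ) → ¬ ((suc n · 1#) ≈ 0#)

  ι : ℤ → Carrier
  ι (+ n)    = n · 1#
  ι -[1+ n ] = - (suc n · 1#)

  sumTo : ℕ → (ℕ → Carrier) → Carrier
  sumTo zero    f = f 0
  sumTo (suc k) f = sumTo k f + f (suc k)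

  -- A polynomial p(x) = Σ a_k x^k is represented by its coefficient
  -- sequence a : ℕ → F.  It has degree m iff a m ≠ 0 and a j = 0 for j > m.
  HasDegree : (ℕ → Carrier) → ℕ → Set ℓ
  HasDegree a m = ¬ (a m ≈ 0#) × (∀ j → m ℕ.< j → a j ≈ 0#)

  SkewPalindromic : (ℕ → Carrier) → ℕ → Set ℓ
  SkewPalindromic a m = ∀ k → k ≤ m → a k ≈ - a (m ∸ k)

  -- entries of the binomial array B(p(x)):
  -- a_{k,n} = coefficient of x^k in (1+x)^n p(x) = Σ_{j=0}^{k} binom(n, k-j) a_j
  binArray : (ℕ → Carrier) → ℕ → ℤ → Carrier
  binArray a k n = sumTo k (λ j → ι (gbinom n (k ∸ j)) * a j)

-- Column n of B(p) is the coefficient sequence of (1+x)^n p(x).  Multiplying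
-- by the palindromic polynomial 1+x turns a skew-palindromic sequence of
-- degree N into one of degree N+1, so every column n ≥ 0 is skew-palindromic
-- of degree n+m.  The middle coefficient c of a skew-palindromic sequence of
-- even degree satisfies c = -c, hence c = 0 when 2 ≠ 0; the claimed entries
-- are exactly these middle coefficients.
module Submission where

open import Defs
open import Data.Nat using (ℕ; suc; _+_; _*_)
open import Data.Integer using (+_)
open import Data.Product using (_×_)
open import Relation.Binary.PropositionalEquality using (_≡_)

open import Data.Nat as ℕ using (zero; z≤n; s≤s; _≤_; _<_; _∸_)
import Data.Nat.Properties as ℕ
open import Data.Nat.Combinatorics using (_C_; nCk+nC[k+1]≡[n+1]C[k+1])
open import Data.Nat.Tactic.RingSolver using (solve-∀)
open import Data.Product using (_,_; proj₁)
open import Data.Sum using (inj₁; inj₂)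
open import Relation.Nullary using (¬_)
import Relation.Binary.PropositionalEquality as ≡
import Algebra.Properties.AbelianGroup as AbelianGroupProperties
import Algebra.Properties.CommutativeSemigroup as CommutativeSemigroupProperties
import Algebra.Properties.Monoid.Mult as MonoidMult
import Algebra.Properties.Semiring.Mult as SemiringMult
import Relation.Binary.Reasoning.Setoid as SetoidReasoning

module _ {c ℓ} (F : Field c ℓ) where
  open Field F renaming (_+_ to _⊕_; _*_ to _⊗_)
  open SetoidReasoning setoid
  open AbelianGroupProperties +-abelianGroup using (⁻¹-∙-comm; ⁻¹-selfInverse)
  open CommutativeSemigroupProperties +-commutativeSemigroup
    using (interchange; xy∙z≈xz∙y)
  open MonoidMult +-monoid using (×-homo-+)
  open SemiringMult semiring using (×-assoc-*)

  VanishesAbove : (ℕ → Carrier) → ℕ → Set ℓ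
  VanishesAbove q N = ∀ j → N < j → q j ≈ 0#

  nonzero-cancel : ∀ {u x} → ¬ (u ≈ 0#) → u ⊗ x ≈ 0# → x ≈ 0#
  nonzero-cancel {u} {x} u≉0 ux≈0 with inverse u u≉0
  ... | v , uv≈1 = begin
    x             ≈⟨ *-identityˡ x ⟨
    1# ⊗ x        ≈⟨ *-congʳ uv≈1 ⟨
    (u ⊗ v) ⊗ x   ≈⟨ *-congʳ (*-comm u v) ⟩
    (v ⊗ u) ⊗ x   ≈⟨ *-assoc v u x ⟩
    v ⊗ (u ⊗ x)   ≈⟨ *-congˡ ux≈0 ⟩
    v ⊗ 0#        ≈⟨ zeroʳ v ⟩
    0#            ∎

  x≈-x⇒x≈0 : ¬ (ι F (+ 2) ≈ 0#) → ∀ {x} → x ≈ - x → x ≈ 0#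
  x≈-x⇒x≈0 2≉0 {x} x≈-x = nonzero-cancel 2≉0 (begin
    ι F (+ 2) ⊗ x   ≈⟨ ×-assoc-* 2 1# x ⟩
    x′ ⊕ (x′ ⊕ 0#)  ≈⟨ +-cong (*-identityˡ x) (+-identityʳ x′) ⟩
    x ⊕ x′          ≈⟨ +-congˡ (*-identityˡ x) ⟩
    x ⊕ x           ≈⟨ +-congˡ x≈-x ⟩
    x ⊕ - x         ≈⟨ -‿inverseʳ x ⟩
    0#              ∎)
    where x′ = 1# ⊗ x

  middle≈0 : ¬ (ι F (+ 2) ≈ 0#) → ∀ {q N} h → N ≡ h + h →
             SkewPalindromic F q N → q h ≈ 0#
  middle≈0 2≉0 {q} h ≡.refl skew = x≈-x⇒x≈0 2≉0 (begin
    q h                 ≈⟨ skew h (ℕ.m≤m+n h h) ⟩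
    - q (h + h ∸ h)     ≈⟨ -‿cong (reflexive (≡.cong q (ℕ.m+n∸n≡m h h))) ⟩
    - q h               ∎)

  skewPalindromic-cong : ∀ {q r N} → (∀ j → q j ≈ r j) →
                         SkewPalindromic F q N → SkewPalindromic F r N
  skewPalindromic-cong {N = N} q≈r skew j j≤N =
    trans (sym (q≈r j)) (trans (skew j j≤N) (-‿cong (q≈r (N ∸ j))))

  vanishesAbove-cong : ∀ {q r N} → (∀ j → q j ≈ r j) →
                       VanishesAbove q N → VanishesAbove r N
  vanishesAbove-cong q≈r vanish j N<j = trans (sym (q≈r j)) (vanish j N<j)

  module TimesOnePlusX {q r : ℕ → Carrier} {N : ℕ}
    (r₀ : r 0 ≈ q 0) (rₛ : ∀ j → r (suc j) ≈ q (suc j) ⊕ q j)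
    (vanish : VanishesAbove q N) where

    vanishesAbove-suc : VanishesAbove r (suc N)
    vanishesAbove-suc (suc j) (s≤s N<j) = begin
      r (suc j)         ≈⟨ rₛ j ⟩
      q (suc j) ⊕ q j   ≈⟨ +-cong (vanish (suc j) (ℕ.m<n⇒m<1+n N<j)) (vanish j N<j) ⟩
      0# ⊕ 0#           ≈⟨ +-identityʳ 0# ⟩
      0#                ∎

    leading : r (suc N) ≈ q N
    leading = begin
      r (suc N)         ≈⟨ rₛ N ⟩
      q (suc N) ⊕ q N   ≈⟨ +-congʳ (vanish (suc N) ℕ.≤-refl) ⟩
      0# ⊕ q N          ≈⟨ +-identityˡ (q N) ⟩
      q N               ∎

    skewPalindromic-suc : SkewPalindromic F q N → SkewPalindromic F r (suc N)
    skewPalindromic-suc skew = skew′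
      where
      bottom : r 0 ≈ - r (suc N)
      bottom = trans r₀ (trans (skew 0 z≤n) (-‿cong (sym leading)))

      skew′ : SkewPalindromic F r (suc N)
      skew′ zero _ = bottom
      skew′ (suc i) (s≤s i≤N) with ℕ.m≤n⇒m<n∨m≡n i≤N
      ... | inj₂ ≡.refl = begin
        r (suc i)       ≈⟨ sym (⁻¹-selfInverse (sym bottom)) ⟩
        - r 0           ≈⟨ -‿cong (reflexive (≡.cong r (ℕ.n∸n≡0 i))) ⟨
        - r (i ∸ i)     ∎
      ... | inj₁ i<N = begin
        r (suc i)               ≈⟨ rₛ i ⟩
        q (suc i) ⊕ q i         ≈⟨ +-cong (skew (suc i) i<N) (skew i i≤N) ⟩
        - q t ⊕ - q (N ∸ i)     ≈⟨ +-congˡ (-‿cong (reflexive (≡.cong q N∸i≡1+t))) ⟩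
        - q t ⊕ - q (suc t)     ≈⟨ ⁻¹-∙-comm (q t) (q (suc t)) ⟩
        - (q t ⊕ q (suc t))     ≈⟨ -‿cong (+-comm (q t) (q (suc t))) ⟩
        - (q (suc t) ⊕ q t)     ≈⟨ -‿cong (rₛ t) ⟨
        - r (suc t)             ≈⟨ -‿cong (reflexive (≡.cong r N∸i≡1+t)) ⟨
        - r (N ∸ i)             ∎
        where
        t = N ∸ suc i
        N∸i≡1+t : N ∸ i ≡ suc t
        N∸i≡1+t = ℕ.+-∸-assoc 1 i<N

  open TimesOnePlusX public using (vanishesAbove-suc; skewPalindromic-suc)

  sumTo-cong : ∀ k {f g} → (∀ i → i ≤ k → f i ≈ g i) → sumTo F k f ≈ sumTo F k g
  sumTo-cong zero    f≈g = f≈g 0 z≤n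
  sumTo-cong (suc k) f≈g =
    +-cong (sumTo-cong k (λ i i≤k → f≈g i (ℕ.m≤n⇒m≤1+n i≤k))) (f≈g (suc k) ℕ.≤-refl)

  sumTo-≈0 : ∀ k {f} → (∀ i → i ≤ k → f i ≈ 0#) → sumTo F k f ≈ 0#
  sumTo-≈0 zero    f≈0 = f≈0 0 z≤n
  sumTo-≈0 (suc k) f≈0 = trans
    (+-cong (sumTo-≈0 k (λ i i≤k → f≈0 i (ℕ.m≤n⇒m≤1+n i≤k))) (f≈0 (suc k) ℕ.≤-refl))
    (+-identityʳ 0#)

  sumTo-⊕ : ∀ k f g → sumTo F k (λ i → f i ⊕ g i) ≈ sumTo F k f ⊕ sumTo F k g
  sumTo-⊕ zero    f g = refl
  sumTo-⊕ (suc k) f g = trans (+-congʳ (sumTo-⊕ k f g)) (interchange _ _ _ _)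

  ι-pascal : ∀ n t → ι F (+ (suc n C suc t)) ≈ ι F (+ (n C suc t)) ⊕ ι F (+ (n C t))
  ι-pascal n t = begin
    ι F (+ (suc n C suc t))                 ≡⟨ ≡.cong (λ s → ι F (+ s)) (nCk+nC[k+1]≡[n+1]C[k+1] n t) ⟨
    ι F (+ (n C t ℕ.+ n C suc t))           ≈⟨ ×-homo-+ 1# (n C t) (n C suc t) ⟩
    ι F (+ (n C t)) ⊕ ι F (+ (n C suc t))   ≈⟨ +-comm _ _ ⟩
    ι F (+ (n C suc t)) ⊕ ι F (+ (n C t))   ∎

  module Columns (a : ℕ → Carrier) where

    term : ℕ → ℕ → ℕ → Carrier
    term n t i = ι F (+ (n C t)) ⊗ a i

    column : ℕ → ℕ → Carrier
    column n j = binArray F a j (+ n)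

    term-pascal : ∀ n t i → term (suc n) (suc t) i ≈ term n (suc t) i ⊕ term n t i
    term-pascal n t i = trans (*-congʳ (ι-pascal n t)) (distribʳ (a i) _ _)

    term-at-0 : ∀ n t i → t ≡ 0 → term n t i ≈ a i
    term-at-0 n t i ≡.refl = trans (*-congʳ (+-identityʳ 1#)) (*-identityˡ (a i))

    column-zero : ∀ j → column 0 j ≈ a j
    column-zero zero    = term-at-0 0 0 0 ≡.refl
    column-zero (suc j) = begin
      column 0 (suc j)                 ≈⟨ +-cong (sumTo-≈0 j lower) (term-at-0 0 (j ∸ j) (suc j) (ℕ.n∸n≡0 j)) ⟩
      0# ⊕ a (suc j)                   ≈⟨ +-identityˡ (a (suc j)) ⟩
      a (suc j)                        ∎
      where
      lower : ∀ i → i ≤ j → term 0 (suc j ∸ i) i ≈ 0#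
      lower i i≤j = trans (reflexive (≡.cong (λ t → term 0 t i) (ℕ.+-∸-assoc 1 i≤j)))
                          (zeroˡ (a i))

    column-suc : ∀ n j →
                 column (suc n) (suc j) ≈ column n (suc j) ⊕ column n j
    column-suc n j = begin
      column (suc n) (suc j)
        ≈⟨ +-cong (sumTo-cong j pascal) (trans (term-at-0 (suc n) (j ∸ j) (suc j) j∸j≡0)
                                               (sym (term-at-0 n (j ∸ j) (suc j) j∸j≡0))) ⟩
      sumTo F j (λ i → term n (suc j ∸ i) i ⊕ term n (j ∸ i) i) ⊕ last
        ≈⟨ +-congʳ (sumTo-⊕ j _ _) ⟩
      (sumTo F j (λ i → term n (suc j ∸ i) i) ⊕ column n j) ⊕ last
        ≈⟨ xy∙z≈xz∙y _ _ _ ⟩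
      column n (suc j) ⊕ column n j
        ∎
      where
      last = term n (j ∸ j) (suc j)
      j∸j≡0 = ℕ.n∸n≡0 j
      pascal : ∀ i → i ≤ j →
               term (suc n) (suc j ∸ i) i ≈ term n (suc j ∸ i) i ⊕ term n (j ∸ i) i
      pascal i i≤j rewrite ℕ.+-∸-assoc 1 i≤j = term-pascal n (j ∸ i) i

    column-skewPalindromic : ∀ {m} → SkewPalindromic F a m → VanishesAbove a m →
      ∀ n → SkewPalindromic F (column n) (n + m) × VanishesAbove (column n) (n + m)
    column-skewPalindromic skew vanish zero =
      skewPalindromic-cong (λ j → sym (column-zero j)) skew ,
      vanishesAbove-cong (λ j → sym (column-zero j)) vanish
    column-skewPalindromic skew vanish (suc n)
      with column-skewPalindromic skew vanish n
    ... | skewₙ , vanishₙ =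
      skewPalindromic-suc refl (column-suc n) vanishₙ skewₙ ,
      vanishesAbove-suc refl (column-suc n) vanishₙ

  open Columns public using (column-skewPalindromic)

proposition6p5 : ∀ {c ℓ} (F : Field c ℓ) → CharZero F →
    (a : ℕ → Field.Carrier F) (m : ℕ) →
    HasDegree F a m → SkewPalindromic F a m →
    (∀ l → m ≡ 2 * l →
      Field._≈_ F (a l) (Field.0# F)
      × (∀ k → Field._≈_ F (binArray F a (l + k) (+ (2 * k))) (Field.0# F)))
    × (∀ l → m ≡ suc (2 * l) →
      Field._≈_ F (binArray F a (suc l) (+ 1)) (Field.0# F)
      × (∀ k → Field._≈_ F (binArray F a (suc (l + k)) (+ suc (2 * k))) (Field.0# F)))
proposition6p5 F charZero a m (_ , vanish) skew =
  (λ l m≡2l →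
    middle l (≡.trans m≡2l (double l)) skew ,
    λ k → middle (l + k) (≡.trans (≡.cong (ℕ._+_ (2 * k)) m≡2l) (even-split k l)) (column-skew (2 * k))) ,
  (λ l m≡1+2l →
    middle (suc l) (≡.trans (≡.cong (ℕ._+_ 1) m≡1+2l) (first-odd-split l)) (column-skew 1) ,
    λ k → middle (suc (l + k)) (≡.trans (≡.cong (ℕ._+_ (suc (2 * k))) m≡1+2l) (odd-split k l))
                 (column-skew (suc (2 * k))))
  where
  middle : ∀ {q N} h → N ≡ h + h → SkewPalindromic F q N → Field._≈_ F (q h) (Field.0# F)
  middle = middle≈0 F (charZero 1)

  column-skew : ∀ n → SkewPalindromic F (λ j → binArray F a j (+ n)) (n + m)
  column-skew n = proj₁ (column-skewPalindromic F a skew vanish n)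

  double : ∀ l → 2 * l ≡ l + l
  double = solve-∀
  even-split : ∀ k l → 2 * k + 2 * l ≡ (l + k) + (l + k)
  even-split = solve-∀
  first-odd-split : ∀ l → 1 + suc (2 * l) ≡ suc l + suc l
  first-odd-split = solve-∀
  odd-split : ∀ k l → suc (2 * k) + suc (2 * l) ≡ suc (l + k) + suc (l + k)
  odd-split = solve-∀
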